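{- For all positive integers $k$ and $l$, there exists a weakly connected digraph $D$ with exactly $k$ sources such that, for every positive integer $m$, the $m$-step competition graph $C^m(D)$ has exactly $l$ components.
   Context: All digraphs are finite, may have loops, and (standing assumption) every vertex has outdegree at least $1$. For a positive integer $m$, a vertex $y$ is an $m$-step prey of $x$ if there is a directed walk of length $m$ from $x$ to $y$. The $m$-step competition graph $C^m(D)$ has vertex set $V(D)$ and an edge between distinct vertices $x,y$ iff they have a common $m$-step prey. A source is a vertex of indegree $0$. $D$ is weakly connected if its underlying undirected graph is connected. -}

module Defs where

open import Data.Nat using (ℕ; zero; suc; _≥_)
open import Data.Fin using (Fin)
open import Data.Bool using (Bool; true; false; T; not)
open import Data.List using (List; []; _∷_; length; filter)
open import Data.List using () renaming (allFin to finList)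
open import Data.Product using (Σ; ∃; ∃-syntax; _×_; _,_)
open import Data.Sum using (_⊎_)
open import Relation.Nullary using (¬_)
open import Relation.Binary.PropositionalEquality using (_≡_)
open import Relation.Unary using (Pred)
open import Data.Bool using (T?)
open import Data.Bool.ListAction using (any)
open import Function using (_∘_)

-- A finite digraph (loops allowed) on vertex set Fin n, given by its
-- Boolean adjacency: arc x y = true iff there is an arc x → y.
record Digraph : Set where
  field
    n   : ℕ
    arc : Fin n → Fin n → Bool

open Digraph public

OutdegPositive : Digraph → Set
OutdegPositive D = ∀ x → ∃[ y ] T (arc D x y)

data Walk (D : Digraph) : ℕ → Fin (n D) → Fin (n D) → Set where
  here : ∀ {x} → Walk D zero x x
  step : ∀ {m x y z} → T (arc D x y) → Walk D m y z → Walk D (suc m) x z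

Prey : (D : Digraph) → ℕ → Fin (n D) → Fin (n D) → Set
Prey D m x y = Walk D m x y

CompEdge : (D : Digraph) → ℕ → Fin (n D) → Fin (n D) → Set
CompEdge D m x y = ¬ (x ≡ y) × ∃[ z ] (Prey D m x z × Prey D m y z)

-- Connectedness (reflexive-transitive path) in an undirected graph
-- given by an edge relation E (symmetric in our uses).
data Connected {V : Set} (E : V → V → Set) : V → V → Set where
  refl-c : ∀ {x} → Connected E x x
  edge-c : ∀ {x y z} → E x y → Connected E y z → Connected E x z

-- A graph on V with edge relation E has exactly l components:
-- there is a surjective labelling of vertices by Fin l such that
-- two vertices get the same label iff they lie in the same component.
HasComponents : {V : Set} → (V → V → Set) → ℕ → Set
HasComponents {V} E l =
  Σ (V → Fin l) λ c →
    (∀ (i : Fin l) → ∃[ x ] (c x ≡ i)) ×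
    (∀ x y → (c x ≡ c y → Connected E x y) × (Connected E x y → c x ≡ c y))

UndirArc : (D : Digraph) → Fin (n D) → Fin (n D) → Set
UndirArc D x y = T (arc D x y) ⊎ T (arc D y x)

WeaklyConnected : Digraph → Set
WeaklyConnected D = ∀ x y → Connected (UndirArc D) x y

isSource : (D : Digraph) → Fin (n D) → Bool
isSource D x = not (any (λ y → arc D y x) (finList (n D)))

numSources : Digraph → ℕ
numSources D = length (filter (T? ∘ isSource D) (finList (n D)))

-- Take a directed cycle of length l (a loop when l = 1) and k further vertices, each
-- with a single arc into the same cycle vertex. Every outdegree is exactly one, so the
-- digraph is the graph of a map f: the m-step prey of x is f^m x alone, and C^m(D)
-- joins x ≠ y exactly when f^m x = f^m y. Its components are thus the fibres of f^m,
-- and for m ≥ 1 the image of f^m is the whole cycle, giving l components. The k extra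
-- vertices have no in-arc, while each cycle vertex has its predecessor, so they are
-- exactly the sources.
module Submission where

open import Defs
open import Data.Nat using (ℕ; _≥_; zero; suc; _+_)
import Data.Nat as ℕ
open import Data.Nat.Properties using (suc-injective)
open import Data.Nat.GeneralisedArithmetic using (iterate)
open import Data.Fin using (Fin; zero; suc; _↑ˡ_; _↑ʳ_; splitAt; fromℕ; inject₁; lower₁; toℕ; _≟_)
open import Data.Fin.Properties
  using (splitAt-↑ˡ; splitAt-↑ʳ; toℕ-fromℕ; toℕ-injective; toℕ-inject₁; inject₁-lower₁; ↑ˡ-injective)
open import Data.Product using (∃-syntax; _×_; _,_)
open import Data.Sum using (inj₁; [_,_]′; swap)
open import Data.Bool using (true; false; T; not; T?)
open import Data.List using (_∷_; _++_; length; filter; tabulate; allFin)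
open import Data.List.Properties using (filter-++; filter-all; filter-none; length-tabulate)
open import Data.List.Relation.Unary.All.Properties using (tabulate⁺)
open import Data.List.Relation.Unary.Any.Properties using (any⁺; any⁻)
open import Data.List.Membership.Propositional using (lose; find)
open import Data.List.Membership.Propositional.Properties using (∈-allFin)
open import Function using (_∘_; const)
open import Relation.Binary.Definitions using (DecidableEquality)
open import Relation.Binary.PropositionalEquality
open import Relation.Nullary using (¬_; yes; no)
open import Relation.Nullary.Decidable using (⌊_⌋; toWitness; fromWitness)
open import Relation.Unary using (Pred; Decidable)

module _ {V : Set} {E : V → V → Set} where

  Connected-trans : ∀ {x y z} → Connected E x y → Connected E y z → Connected E x z
  Connected-trans refl-c       q = q
  Connected-trans (edge-c e p) q = edge-c e (Connected-trans p q)

  Connected-sym : (∀ {x y} → E x y → E y x) → ∀ {x y} → Connected E x y → Connected E y x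
  Connected-sym sym-E refl-c       = refl-c
  Connected-sym sym-E (edge-c e p) = Connected-trans (Connected-sym sym-E p) (edge-c (sym-E e) refl-c)

  Connected-preserves : ∀ {W : Set} (h : V → W) → (∀ {x y} → E x y → h x ≡ h y) →
                        ∀ {x y} → Connected E x y → h x ≡ h y
  Connected-preserves h h-E refl-c       = refl
  Connected-preserves h h-E (edge-c e p) = trans (h-E e) (Connected-preserves h h-E p)

  hasComponents-fibres : ∀ {l} → DecidableEquality V → (h : V → Fin l) →
                         (∀ i → ∃[ x ] (h x ≡ i)) →
                         (∀ {x y} → E x y → h x ≡ h y) →
                         (∀ {x y} → ¬ x ≡ y → h x ≡ h y → E x y) →
                         HasComponents E l
  hasComponents-fibres _≟V_ h h-surjective h-E E-h =
    h , h-surjective , λ x y → fibre⇒Connected x y , Connected-preserves h h-E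
    where
    fibre⇒Connected : ∀ x y → h x ≡ h y → Connected E x y
    fibre⇒Connected x y hx≡hy with x ≟V y
    ... | yes refl = refl-c
    ... | no  x≢y  = edge-c (E-h x≢y hx≡hy) refl-c

module _ {A : Set} where

  iterate-surjective : {g : A → A} → (∀ y → ∃[ x ] (g x ≡ y)) →
                       ∀ m y → ∃[ x ] (iterate g x m ≡ y)
  iterate-surjective g-surj zero    y = y , refl
  iterate-surjective {g} g-surj (suc m) y with iterate-surjective g-surj m y
  ... | x′ , gᵐx′≡y with g-surj x′
  ... | x , gx≡x′ = x , trans (cong (λ z → iterate g z m) gx≡x′) gᵐx′≡y

  iterate-intertwine : ∀ {B : Set} {f : B → B} {g : A → A} (ι : A → B) →
                       (∀ x → f (ι x) ≡ ι (g x)) →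
                       ∀ m x → iterate f (ι x) m ≡ ι (iterate g x m)
  iterate-intertwine ι fι≡ιg zero    x = refl
  iterate-intertwine {f = f} {g} ι fι≡ιg (suc m) x =
    trans (cong (λ z → iterate f z m) (fι≡ιg x)) (iterate-intertwine ι fι≡ιg m (g x))

tabulate-+ : ∀ {A : Set} m n (f : Fin (m + n) → A) →
             tabulate f ≡ tabulate (f ∘ (_↑ˡ n)) ++ tabulate (f ∘ (m ↑ʳ_))
tabulate-+ zero    n f = refl
tabulate-+ (suc m) n f = cong (f zero ∷_) (tabulate-+ m n (f ∘ suc))

count-↑ʳ : ∀ m n {p} {P : Pred (Fin (m + n)) p} (P? : Decidable P) →
           (∀ i → ¬ P (i ↑ˡ n)) → (∀ j → P (m ↑ʳ j)) →
           length (filter P? (allFin (m + n))) ≡ n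
count-↑ʳ m n P? ¬P↑ˡ P↑ʳ = begin
  length (filter P? (allFin (m + n)))
    ≡⟨ cong (length ∘ filter P?) (tabulate-+ m n (λ i → i)) ⟩
  length (filter P? (left ++ right))
    ≡⟨ cong length (filter-++ P? left right) ⟩
  length (filter P? left ++ filter P? right)
    ≡⟨ cong₂ (λ xs ys → length (xs ++ ys)) (filter-none P? (tabulate⁺ ¬P↑ˡ)) (filter-all P? (tabulate⁺ P↑ʳ)) ⟩
  length right
    ≡⟨ length-tabulate (m ↑ʳ_) ⟩
  n ∎
  where
  open ≡-Reasoning
  left  = tabulate (_↑ˡ n)
  right = tabulate (m ↑ʳ_)

↑ˡ≢↑ʳ : ∀ {m n} (i : Fin m) (j : Fin n) → ¬ i ↑ˡ n ≡ m ↑ʳ j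
↑ˡ≢↑ʳ {m} {n} i j eq
  with () ← trans (sym (splitAt-↑ˡ m i n)) (trans (cong (splitAt m) eq) (splitAt-↑ʳ m n j))

T⇒¬T-not : ∀ {b} → T b → ¬ T (not b)
T⇒¬T-not {true} _ ()

¬T⇒T-not : ∀ {b} → ¬ T b → T (not b)
¬T⇒T-not {true}  ¬t = ¬t _
¬T⇒T-not {false} _  = _

module FunctionalDigraph {size : ℕ} (f : Fin size → Fin size) where

  graph : Digraph
  graph = record { n = size ; arc = λ x y → ⌊ f x ≟ y ⌋ }

  arc⇒≡ : ∀ {x y} → T (arc graph x y) → f x ≡ y
  arc⇒≡ = toWitness

  ≡⇒arc : ∀ {x y} → f x ≡ y → T (arc graph x y)
  ≡⇒arc = fromWitness

  outdegPositive : OutdegPositive graph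
  outdegPositive x = f x , ≡⇒arc refl

  walk⇒iterate : ∀ {m x z} → Walk graph m x z → iterate f x m ≡ z
  walk⇒iterate here = refl
  walk⇒iterate {suc m} (step x→y w) = trans (cong (λ y → iterate f y m) (arc⇒≡ x→y)) (walk⇒iterate w)

  iterate-walk : ∀ m x → Walk graph m x (iterate f x m)
  iterate-walk zero    x = here
  iterate-walk (suc m) x = step (≡⇒arc refl) (iterate-walk m (f x))

  compEdge⇒iterate≡ : ∀ {m x y} → CompEdge graph m x y → iterate f x m ≡ iterate f y m
  compEdge⇒iterate≡ (_ , z , x⇝z , y⇝z) = trans (walk⇒iterate x⇝z) (sym (walk⇒iterate y⇝z))

  iterate≡⇒compEdge : ∀ {m x y} → ¬ x ≡ y → iterate f x m ≡ iterate f y m → CompEdge graph m x y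
  iterate≡⇒compEdge {m} {x} {y} x≢y fᵐx≡fᵐy =
    x≢y , iterate f x m , iterate-walk m x , subst (Walk graph m y) (sym fᵐx≡fᵐy) (iterate-walk m y)

  hasComponents : ∀ {l m} (ι : Fin l → Fin size) (h : Fin size → Fin l) →
                  (∀ {i j} → ι i ≡ ι j → i ≡ j) → (∀ i → ∃[ x ] (h x ≡ i)) →
                  (∀ x → iterate f x m ≡ ι (h x)) →
                  HasComponents (CompEdge graph m) l
  hasComponents ι h ι-injective h-surjective fᵐ≡ιh =
    hasComponents-fibres _≟_ h h-surjective
      (λ {x} {y} e → ι-injective (trans (sym (fᵐ≡ιh x)) (trans (compEdge⇒iterate≡ e) (fᵐ≡ιh y))))
      (λ {x} {y} x≢y hx≡hy → iterate≡⇒compEdge x≢y (trans (fᵐ≡ιh x) (trans (cong ι hx≡hy) (sym (fᵐ≡ιh y)))))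

  Connected-iterate : ∀ m x → Connected (UndirArc graph) x (iterate f x m)
  Connected-iterate zero    x = refl-c
  Connected-iterate (suc m) x = edge-c (inj₁ (≡⇒arc refl)) (Connected-iterate m (f x))

  image⇒¬isSource : ∀ {x y} → f x ≡ y → ¬ T (isSource graph y)
  image⇒¬isSource {x} fx≡y =
    T⇒¬T-not (any⁺ _ (lose (∈-allFin x) (≡⇒arc fx≡y)))

  ∉image⇒isSource : ∀ {y} → (∀ x → ¬ f x ≡ y) → T (isSource graph y)
  ∉image⇒isSource {y} y∉image = ¬T⇒T-not λ hit →
    let x , _ , x→y = find (any⁻ _ (allFin size) hit) in y∉image x (arc⇒≡ x→y)

cyclePred : ∀ {a} → Fin (suc a) → Fin (suc a)
cyclePred {a} zero    = fromℕ a
cyclePred     (suc i) = inject₁ i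

cyclePred-surjective : ∀ {a} (i : Fin (suc a)) → ∃[ j ] (cyclePred j ≡ i)
cyclePred-surjective {a} i with a ℕ.≟ toℕ i
... | yes a≡i = zero , toℕ-injective (trans (toℕ-fromℕ a) a≡i)
... | no  a≢i = suc (lower₁ i a≢i) , inject₁-lower₁ i a≢i

iterate-cyclePred-toℕ : ∀ {a} m (i : Fin (suc a)) → toℕ i ≡ m → iterate cyclePred i m ≡ zero
iterate-cyclePred-toℕ zero    zero    _   = refl
iterate-cyclePred-toℕ (suc m) (suc i) i≡m =
  iterate-cyclePred-toℕ m (inject₁ i) (trans (toℕ-inject₁ i) (suc-injective i≡m))

-- The vertices i ↑ˡ k form the cycle i ↦ i − 1 of length suc a; each pendant vertex
-- suc a ↑ʳ j has its only arc into zero ↑ˡ k.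
module CycleWithPendantSources (a k : ℕ) where

  retract : Fin (suc a + k) → Fin (suc a)
  retract = [ cyclePred , const zero ]′ ∘ splitAt (suc a)

  open FunctionalDigraph ((_↑ˡ k) ∘ retract) public

  retract-↑ˡ : ∀ i → retract (i ↑ˡ k) ≡ cyclePred i
  retract-↑ˡ i = cong [ cyclePred , const zero ]′ (splitAt-↑ˡ (suc a) i k)

  iterate-suc : ∀ m x → iterate ((_↑ˡ k) ∘ retract) x (suc m) ≡ iterate cyclePred (retract x) m ↑ˡ k
  iterate-suc m x = iterate-intertwine (_↑ˡ k) (cong (_↑ˡ k) ∘ retract-↑ˡ) m (retract x)

  components : ∀ m → HasComponents (CompEdge graph (suc m)) (suc a)
  components m =
    hasComponents (_↑ˡ k) (λ x → iterate cyclePred (retract x) m)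
      (↑ˡ-injective k _ _) surjective (iterate-suc m)
    where
    surjective : ∀ i → ∃[ x ] (iterate cyclePred (retract x) m ≡ i)
    surjective i with j , cyclePredᵐ⁺¹j≡i ← iterate-surjective cyclePred-surjective (suc m) i =
      j ↑ˡ k , trans (cong (λ z → iterate cyclePred z m) (retract-↑ˡ j)) cyclePredᵐ⁺¹j≡i

  weaklyConnected : WeaklyConnected graph
  weaklyConnected x y = Connected-trans (toRoot x) (Connected-sym swap (toRoot y))
    where
    toRoot : ∀ x → Connected (UndirArc graph) x (zero ↑ˡ k)
    toRoot x = subst (Connected (UndirArc graph) x)
      (trans (iterate-suc m x) (cong (_↑ˡ k) (iterate-cyclePred-toℕ m (retract x) refl)))
      (Connected-iterate (suc m) x)
      where m = toℕ (retract x)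

  numSources≡k : numSources graph ≡ k
  numSources≡k = count-↑ʳ (suc a) k (T? ∘ isSource graph) cycle-¬source pendant-source
    where
    cycle-¬source : ∀ i → ¬ T (isSource graph (i ↑ˡ k))
    cycle-¬source i with j , cyclePredj≡i ← cyclePred-surjective i =
      image⇒¬isSource {x = j ↑ˡ k} (cong (_↑ˡ k) (trans (retract-↑ˡ j) cyclePredj≡i))
    pendant-source : ∀ j → T (isSource graph (suc a ↑ʳ j))
    pendant-source j = ∉image⇒isSource (λ x → ↑ˡ≢↑ʳ (retract x) j)

lemma2p2 : ∀ (k l : ℕ) → k ≥ 1 → l ≥ 1 →
    ∃[ D ] (OutdegPositive D × WeaklyConnected D × numSources D ≡ k ×
      (∀ (m : ℕ) → m ≥ 1 → HasComponents (CompEdge D m) l))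
lemma2p2 (suc k) (suc a) _ _ =
  graph , outdegPositive , weaklyConnected , numSources≡k , λ { (suc m) _ → components m }
  where open CycleWithPendantSources a (suc k)
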